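{- Let $\rho\ge2$ and $\mu\ge1$ be natural numbers and let $K$ be a quasi-arithmetic compact set of module $\mu$ and ratio $\rho$ (of order type $\omega^\omega+1$ under $\preccurlyeq$). For $u\in\mathbf{Z}_{\ge0}$ put $T_u=K^{(u)}\setminus K^{(u+1)}$. Let $n$ be a natural number and $p,q,v,w$ integers with $v,w\ge0$ such that $\frac{n}{\rho^p}\in T_v$ and $\frac{n}{\rho^q}\in T_w$. Then $p\mu-v=q\mu-w$.
   Context: For $A\subset\mathbf{R}$, $A'$ denotes the derived set of $A$, $A^{(0)}=A$, $A^{(n+1)}=(A^{(n)})'$. The order $\preccurlyeq$ is given by $x\preccurlyeq y$ iff $x\ge y$. A compact $K\subset[0,+\infty)$ is a self-similar compact set of ratio $\rho>1$ and module $\mu\in\mathbf{N}$ if $\rho K^{(\mu)}=K$ and $K$ is well ordered by $\preccurlyeq$. Such a $K$ is quasi-arithmetic if $\rho\ge2$ is a natural number and there is a function $\kappa:\mathbf{N}\setminus\rho\mathbf{N}\to\mathbf{Z}_{\ge0}$ with $K\setminus\{0\}=\{\frac{m}{\rho^k}: \rho\nmid m,\ k\ge\kappa(m)\}$. -}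

module Defs where

open import Level using (0ℓ)
open import Data.Nat as ℕ using (ℕ; zero; suc)
open import Data.Nat.Divisibility using (_∣_)
open import Data.Integer as ℤ using (ℤ; +_; -[1+_])
open import Data.Rational using (ℚ; _/_; _*_; _-_; ∣_∣; _<_; _≤_; 0ℚ; 1ℚ)
open import Data.Product using (Σ; _×_; ∃)
open import Relation.Nullary using (¬_)
open import Relation.Binary.PropositionalEquality using (_≡_; _≢_)
open import Function.Bundles using (_⇔_)

-- subsets of ℚ (every set in the statement lies in ℚ)
Pred : Set₁
Pred = ℚ → Set

ℕ→ℚ : ℕ → ℚ
ℕ→ℚ n = + n / 1

-- 1/ρ (only used for ρ ≥ 2)
invρ : ℕ → ℚ
invρ zero    = 0ℚ
invρ (suc k) = + 1 / suc k

powℚ : ℚ → ℕ → ℚ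
powℚ x zero    = 1ℚ
powℚ x (suc k) = x * powℚ x k

ρ^ℤ : ℕ → ℤ → ℚ
ρ^ℤ ρ (+ k)     = powℚ (ℕ→ℚ ρ) k
ρ^ℤ ρ -[1+ k ]  = powℚ (invρ ρ) (suc k)

_/[_]^_ : ℕ → ℕ → ℤ → ℚ
n /[ ρ ]^ p = ℕ→ℚ n * ρ^ℤ ρ (ℤ.- p)

-- x is an accumulation point of A (in ℝ, restricted to rational x)
Derived : Pred → Pred
Derived A x = ∀ ε → 0ℚ < ε → Σ ℚ λ y → A y × y ≢ x × ∣ y - x ∣ < ε

DerivedN : ℕ → Pred → Pred
DerivedN zero    A = A
DerivedN (suc n) A = Derived (DerivedN n A)

T : Pred → ℕ → Pred
T K u x = DerivedN u K x × ¬ DerivedN (suc u) K x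

IsCauchy : (ℕ → ℚ) → Set
IsCauchy s = ∀ ε → 0ℚ < ε → Σ ℕ λ N → ∀ i j → N ℕ.≤ i → N ℕ.≤ j → ∣ s i - s j ∣ < ε

ConvergesTo : (ℕ → ℚ) → ℚ → Set
ConvergesTo s L = ∀ ε → 0ℚ < ε → Σ ℕ λ N → ∀ i → N ℕ.≤ i → ∣ s i - L ∣ < ε

-- K ⊆ ℚ is closed as a subset of ℝ: every Cauchy sequence in K has a limit in K
IsClosedInℝ : Pred → Set
IsClosedInℝ K = ∀ s → (∀ i → K (s i)) → IsCauchy s → Σ ℚ λ L → K L × ConvergesTo s L

IsBounded : Pred → Set
IsBounded K = Σ ℚ λ B → ∀ x → K x → ∣ x ∣ ≤ B

IsCompact : Pred → Set
IsCompact K = IsClosedInℝ K × IsBounded K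

IsNonneg : Pred → Set
IsNonneg K = ∀ x → K x → 0ℚ ≤ x

-- K well ordered by ≼ (x ≼ y iff x ≥ y): every nonempty subset has a ≼-least,
-- i.e. a largest, element
IsWellOrderedByGe : Pred → Set₁
IsWellOrderedByGe K = ∀ (S : Pred) → (∀ x → S x → K x) → Σ ℚ S →
  Σ ℚ λ m → S m × (∀ x → S x → x ≤ m)

IsSelfSimilar : ℕ → ℕ → Pred → Set₁
IsSelfSimilar ρ μ K =
  IsCompact K × IsNonneg K × IsWellOrderedByGe K ×
  (∀ x → K x ⇔ Σ ℚ λ y → DerivedN μ K y × x ≡ ℕ→ℚ ρ * y)

-- quasi-arithmetic: K \ {0} = { m / ρ^k : ρ ∤ m, k ≥ κ(m) }
-- (κ is given on all of ℕ, only its values on ℕ \ ρℕ matter)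
IsQuasiArithmetic : ℕ → ℕ → Pred → Set₁
IsQuasiArithmetic ρ μ K =
  2 ℕ.≤ ρ × IsSelfSimilar ρ μ K ×
  Σ (ℕ → ℕ) λ κ → ∀ x → (K x × x ≢ 0ℚ) ⇔
    (Σ ℕ λ m → Σ ℕ λ k → ¬ (ρ ∣ m) × κ m ℕ.≤ k × x ≡ ℕ→ℚ m * powℚ (invρ ρ) k)

-- Multiplication by ρ is a homeomorphism of ℚ, so it commutes with taking derived sets, and
-- self-similarity ρ K^(μ) = K then gives ρ K^(u+μ) = K^(u): the point n/ρ^(p+1) lies in T_(v+μ)
-- exactly when n/ρ^p lies in T_v. Derived sets of derived sets are closed, so K^(u+1) ⊆ K^(a+1)
-- for a ≤ u and each point lies in at most one T_u. Hence along the orbit n/ρ^p the level v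
-- determines p, and p μ - v is constant on it.
module Submission where

open import Defs
open import Data.Empty using (⊥-elim)
open import Data.Integer as ℤ using (ℤ; +_; -[1+_]; _+_; _*_; _-_)
import Data.Integer.Properties as ℤ
open import Data.Integer.Solver using (module +-*-Solver)
open import Data.Nat as ℕ using (ℕ; zero; suc; _≤_; s≤s; _≤′_; ≤′-refl; ≤′-step)
import Data.Nat.Coprimality as Coprime
import Data.Nat.Properties as ℕ
open import Data.Product using (Σ; _×_; _,_)
open import Data.Rational as ℚ
  using (ℚ; mkℚ; 0ℚ; 1ℚ; ∣_∣; 1/_; Positive; NonZero; positive)
  renaming (_+_ to _+ℚ_; _*_ to _*ℚ_; _-_ to _-ℚ_; -_ to -ℚ_; _<_ to _<ℚ_; _≤_ to _≤ℚ_)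
open import Data.Rational.Properties
open import Data.Rational.Solver using (module +-*-Solver)
open import Data.Sum using (_⊎_; inj₁; inj₂)
open import Function.Bundles using (_⇔_; Equivalence)
open import Relation.Binary.Definitions using (tri<; tri≈; tri>)
open import Relation.Binary.PropositionalEquality

private
  module Q = Data.Rational.Solver.+-*-Solver
  module Z = Data.Integer.Solver.+-*-Solver

p-q≡0⇒p≡q : ∀ p q → p -ℚ q ≡ 0ℚ → p ≡ q
p-q≡0⇒p≡q p q eq = begin
  p                 ≡⟨ Q.solve 2 (λ p q → p Q.:= (p Q.:- q) Q.:+ q) refl p q ⟩
  (p -ℚ q) +ℚ q     ≡⟨ cong (_+ℚ q) eq ⟩
  0ℚ +ℚ q           ≡⟨ +-identityˡ q ⟩
  q                 ∎
  where open ≡-Reasoning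

p≢q⇒0<∣p-q∣ : ∀ p q → p ≢ q → 0ℚ <ℚ ∣ p -ℚ q ∣
p≢q⇒0<∣p-q∣ p q p≢q = ≰⇒> λ ∣p-q∣≤0 →
  p≢q (p-q≡0⇒p≡q p q (∣p∣≡0⇒p≡0 (p -ℚ q) (≤-antisym ∣p-q∣≤0 (0≤∣p∣ (p -ℚ q)))))

∣p-q∣≡∣q-p∣ : ∀ p q → ∣ p -ℚ q ∣ ≡ ∣ q -ℚ p ∣
∣p-q∣≡∣q-p∣ p q =
  trans (cong ∣_∣ (Q.solve 2 (λ p q → p Q.:- q Q.:= Q.:- (q Q.:- p)) refl p q)) (∣-p∣≡∣p∣ (q -ℚ p))

∣p-r∣≤∣p-q∣+∣q-r∣ : ∀ p q r → ∣ p -ℚ r ∣ ≤ℚ ∣ p -ℚ q ∣ +ℚ ∣ q -ℚ r ∣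
∣p-r∣≤∣p-q∣+∣q-r∣ p q r =
  subst (_≤ℚ ∣ p -ℚ q ∣ +ℚ ∣ q -ℚ r ∣)
        (cong ∣_∣ (Q.solve 3 (λ p q r → (p Q.:- q) Q.:+ (q Q.:- r) Q.:= p Q.:- r) refl p q r))
        (∣p+q∣≤∣p∣+∣q∣ (p -ℚ q) (q -ℚ r))

Derived-mono : ∀ {A B : Pred} → (∀ x → A x → B x) → ∀ x → Derived A x → Derived B x
Derived-mono A⊆B x D ε ε>0 with D ε ε>0
... | y , Ay , y≢x , close = y , A⊆B y Ay , y≢x , close

0<p⊓q : ∀ {p q} → 0ℚ <ℚ p → 0ℚ <ℚ q → 0ℚ <ℚ p ℚ.⊓ q
0<p⊓q {p} {q} 0<p 0<q with ⊓-sel p q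
... | inj₁ p⊓q≡p = subst (0ℚ <ℚ_) (sym p⊓q≡p) 0<p
... | inj₂ p⊓q≡q = subst (0ℚ <ℚ_) (sym p⊓q≡q) 0<q

Derived²⊆Derived : ∀ (A : Pred) x → Derived (Derived A) x → Derived A x
Derived²⊆Derived A x D ε ε>0 with D ε ε>0
... | y , DAy , y≢x , ∣y-x∣<ε = nearY⇒nearX (DAy δ δ>0)
  where
  d : ℚ
  d = ∣ y -ℚ x ∣
  -- A point of A within min(d, ε - d) of y is distinct from x and within ε of it.
  δ : ℚ
  δ = d ℚ.⊓ (ε -ℚ d)
  δ>0 : 0ℚ <ℚ δ
  δ>0 = 0<p⊓q (p≢q⇒0<∣p-q∣ y x y≢x) (subst (_<ℚ ε -ℚ d) (+-inverseʳ d) (+-monoˡ-< (-ℚ d) ∣y-x∣<ε))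

  nearY⇒nearX : Σ ℚ (λ z → A z × z ≢ y × ∣ z -ℚ y ∣ <ℚ δ) → Σ ℚ λ z → A z × z ≢ x × ∣ z -ℚ x ∣ <ℚ ε
  nearY⇒nearX (z , Az , _ , ∣z-y∣<δ) = z , Az , z≢x , ∣z-x∣<ε
    where
    z≢x : z ≢ x
    z≢x refl = <-irrefl refl (<-≤-trans (subst (_<ℚ δ) (∣p-q∣≡∣q-p∣ z y) ∣z-y∣<δ) (p⊓q≤p d _))
    ∣z-x∣<ε : ∣ z -ℚ x ∣ <ℚ ε
    ∣z-x∣<ε = begin-strict
      ∣ z -ℚ x ∣              ≤⟨ ∣p-r∣≤∣p-q∣+∣q-r∣ z y x ⟩
      ∣ z -ℚ y ∣ +ℚ d         <⟨ +-monoˡ-< d (<-≤-trans ∣z-y∣<δ (p⊓q≤q d _)) ⟩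
      (ε -ℚ d) +ℚ d           ≡⟨ Q.solve 2 (λ ε d → (ε Q.:- d) Q.:+ d Q.:= ε) refl ε d ⟩
      ε                       ∎
      where open ≤-Reasoning

module _ (c : ℚ) .{{c>0 : Positive c}} where
  private instance
    c≢0 : NonZero c
    c≢0 = pos⇒nonZero c
    1/c>0 : Positive (1/ c)
    1/c>0 = 1/pos⇒pos c

  *-cancelˡ-≡-pos : ∀ p q → c *ℚ p ≡ c *ℚ q → p ≡ q
  *-cancelˡ-≡-pos p q eq = begin
    p                      ≡⟨ *-identityˡ p ⟨
    1ℚ *ℚ p                ≡⟨ cong (_*ℚ p) (*-inverseˡ c) ⟨
    (1/ c *ℚ c) *ℚ p       ≡⟨ *-assoc (1/ c) c p ⟩
    1/ c *ℚ (c *ℚ p)       ≡⟨ cong (1/ c *ℚ_) eq ⟩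
    1/ c *ℚ (c *ℚ q)       ≡⟨ *-assoc (1/ c) c q ⟨
    (1/ c *ℚ c) *ℚ q       ≡⟨ cong (_*ℚ q) (*-inverseˡ c) ⟩
    1ℚ *ℚ q                ≡⟨ *-identityˡ q ⟩
    q                      ∎
    where open ≡-Reasoning

  c*[1/c*q]≡q : ∀ q → c *ℚ (1/ c *ℚ q) ≡ q
  c*[1/c*q]≡q q = trans (sym (*-assoc c (1/ c) q)) (trans (cong (_*ℚ q) (*-inverseʳ c)) (*-identityˡ q))

  ∣c*p-c*q∣≡c*∣p-q∣ : ∀ p q → ∣ c *ℚ p -ℚ c *ℚ q ∣ ≡ c *ℚ ∣ p -ℚ q ∣
  ∣c*p-c*q∣≡c*∣p-q∣ p q = begin
    ∣ c *ℚ p -ℚ c *ℚ q ∣     ≡⟨ cong ∣_∣ (Q.solve 3 (λ c p q → c Q.:* p Q.:- c Q.:* q Q.:= c Q.:* (p Q.:- q)) refl c p q) ⟩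
    ∣ c *ℚ (p -ℚ q) ∣        ≡⟨ ∣p*q∣≡∣p∣*∣q∣ c (p -ℚ q) ⟩
    ∣ c ∣ *ℚ ∣ p -ℚ q ∣      ≡⟨ cong (_*ℚ ∣ p -ℚ q ∣) (0≤p⇒∣p∣≡p (<⇒≤ (positive⁻¹ c))) ⟩
    c *ℚ ∣ p -ℚ q ∣          ∎
    where open ≡-Reasoning

  Derived-scale⁺ : ∀ (A : Pred) y → Derived (λ z → A (c *ℚ z)) y → Derived A (c *ℚ y)
  Derived-scale⁺ A y D ε ε>0 with D (1/ c *ℚ ε) (positive⁻¹ _ {{pos*pos⇒pos (1/ c) ε {{positive ε>0}}}})
  ... | z , Acz , z≢y , ∣z-y∣<ε/c = c *ℚ z , Acz , (λ eq → z≢y (*-cancelˡ-≡-pos z y eq)) , (begin-strict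
    ∣ c *ℚ z -ℚ c *ℚ y ∣     ≡⟨ ∣c*p-c*q∣≡c*∣p-q∣ z y ⟩
    c *ℚ ∣ z -ℚ y ∣          <⟨ *-monoʳ-<-pos c ∣z-y∣<ε/c ⟩
    c *ℚ (1/ c *ℚ ε)         ≡⟨ c*[1/c*q]≡q ε ⟩
    ε                        ∎)
    where open ≤-Reasoning

  Derived-scale⁻ : ∀ (A : Pred) y → Derived A (c *ℚ y) → Derived (λ z → A (c *ℚ z)) y
  Derived-scale⁻ A y D ε ε>0 with D (c *ℚ ε) (positive⁻¹ _ {{pos*pos⇒pos c ε {{positive ε>0}}}})
  ... | w , Aw , w≢cy , ∣w-cy∣<cε =
    1/ c *ℚ w , subst A (sym (c*[1/c*q]≡q w)) Aw ,
    (λ eq → w≢cy (trans (sym (c*[1/c*q]≡q w)) (cong (c *ℚ_) eq))) ,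
    *-cancelˡ-<-nonNeg c {{pos⇒nonNeg c}} (subst (_<ℚ c *ℚ ε) ∣w-cy∣≡c*∣w/c-y∣ ∣w-cy∣<cε)
    where
    ∣w-cy∣≡c*∣w/c-y∣ : ∣ w -ℚ c *ℚ y ∣ ≡ c *ℚ ∣ 1/ c *ℚ w -ℚ y ∣
    ∣w-cy∣≡c*∣w/c-y∣ = trans (cong (λ t → ∣ t -ℚ c *ℚ y ∣) (sym (c*[1/c*q]≡q w)))
                             (∣c*p-c*q∣≡c*∣p-q∣ (1/ c *ℚ w) y)

DerivedN-antitone : ∀ (A : Pred) {a b} x → a ℕ.< b → DerivedN b A x → DerivedN (suc a) A x
DerivedN-antitone A x (s≤s a≤b) = go (ℕ.≤⇒≤′ a≤b)
  where
  go : ∀ {a b} → a ≤′ b → DerivedN (suc b) A x → DerivedN (suc a) A x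
  go ≤′-refl D = D
  go {b = suc b} (≤′-step a≤′b) D = go a≤′b (Derived²⊆Derived (DerivedN b A) x D)

T-unique : ∀ (K : Pred) {a b} x → T K a x → T K b x → a ≡ b
T-unique K {a} {b} x (Da , ¬Da+1) (Db , ¬Db+1) with ℕ.<-cmp a b
... | tri< a<b _ _ = ⊥-elim (¬Da+1 (DerivedN-antitone K x a<b Db))
... | tri≈ _ a≡b _ = a≡b
... | tri> _ _ b<a = ⊥-elim (¬Db+1 (DerivedN-antitone K x b<a Da))

module SelfSimilar (K : Pred) (μ : ℕ) (c : ℚ) .{{c>0 : Positive c}}
  (cK^μ≡K : ∀ x → K x ⇔ (Σ ℚ λ y → DerivedN μ K y × x ≡ c *ℚ y)) where

  DerivedN-+μ⇒scale : ∀ u y → DerivedN (u ℕ.+ μ) K y → DerivedN u K (c *ℚ y)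
  DerivedN-+μ⇒scale zero    y D = Equivalence.from (cK^μ≡K (c *ℚ y)) (y , D , refl)
  DerivedN-+μ⇒scale (suc u) y D =
    Derived-scale⁺ c (DerivedN u K) y (Derived-mono (DerivedN-+μ⇒scale u) y D)

  DerivedN-scale⇒+μ : ∀ u y → DerivedN u K (c *ℚ y) → DerivedN (u ℕ.+ μ) K y
  DerivedN-scale⇒+μ zero    y D with Equivalence.to (cK^μ≡K (c *ℚ y)) D
  ... | y′ , D′ , cy≡cy′ = subst (DerivedN μ K) (sym (*-cancelˡ-≡-pos c y y′ cy≡cy′)) D′
  DerivedN-scale⇒+μ (suc u) y D =
    Derived-mono (DerivedN-scale⇒+μ u) y (Derived-scale⁻ c (DerivedN u K) y D)

  T-scale⇒+μ : ∀ u y → T K u (c *ℚ y) → T K (u ℕ.+ μ) y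
  T-scale⇒+μ u y (D , ¬D′) = DerivedN-scale⇒+μ u y D , λ D′ → ¬D′ (DerivedN-+μ⇒scale (suc u) y D′)

module _ (r : ℕ) where
  private
    ρ : ℚ
    ρ = ℕ→ℚ (suc r)

  instance
    ℕ→ℚ-suc-pos : Positive ρ
    ℕ→ℚ-suc-pos = normalize-pos (suc r) 1

  ρ*invρ≡1 : ρ *ℚ invρ (suc r) ≡ 1ℚ
  ρ*invρ≡1 = begin
    ρ *ℚ invρ (suc r)          ≡⟨ cong₂ _*ℚ_ ρ≡ρ′ (normalize-coprime (Coprime.1-coprimeTo (suc r))) ⟩
    ρ′ *ℚ 1/ ρ′                ≡⟨ *-inverseʳ ρ′ ⟩
    1ℚ                         ∎
    where
    open ≡-Reasoning
    ρ′ : ℚ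
    ρ′ = mkℚ (+ suc r) 0 (Coprime.sym (Coprime.1-coprimeTo (suc r)))
    -- normalize (suc r) 1 is ρ′ only propositionally, as gcd does not reduce on a variable
    ρ≡ρ′ : ρ ≡ ρ′
    ρ≡ρ′ = normalize-coprime (Coprime.sym (Coprime.1-coprimeTo (suc r)))

  ρ*ρ^[k-1]≡ρ^k : ∀ k → ρ *ℚ ρ^ℤ (suc r) (k + ℤ.-1ℤ) ≡ ρ^ℤ (suc r) k
  ρ*ρ^[k-1]≡ρ^k (+ zero)  = trans (cong (ρ *ℚ_) (*-identityʳ (invρ (suc r)))) ρ*invρ≡1
  ρ*ρ^[k-1]≡ρ^k (+ suc k) = refl
  ρ*ρ^[k-1]≡ρ^k -[1+ k ]  rewrite ℕ.+-identityʳ k = begin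
    ρ *ℚ (invρ (suc r) *ℚ ρ^ℤ (suc r) -[1+ k ])   ≡⟨ *-assoc ρ (invρ (suc r)) _ ⟨
    (ρ *ℚ invρ (suc r)) *ℚ ρ^ℤ (suc r) -[1+ k ]   ≡⟨ cong (_*ℚ ρ^ℤ (suc r) -[1+ k ]) ρ*invρ≡1 ⟩
    1ℚ *ℚ ρ^ℤ (suc r) -[1+ k ]                    ≡⟨ *-identityˡ _ ⟩
    ρ^ℤ (suc r) -[1+ k ]                          ∎
    where open ≡-Reasoning

  ρ*n/ρ^[p+1]≡n/ρ^p : ∀ n p → ρ *ℚ (n /[ suc r ]^ (p + ℤ.1ℤ)) ≡ n /[ suc r ]^ p
  ρ*n/ρ^[p+1]≡n/ρ^p n p = begin
    ρ *ℚ (ℕ→ℚ n *ℚ ρ^ℤ (suc r) (ℤ.- (p + ℤ.1ℤ)))   ≡⟨ cong (λ k → ρ *ℚ (ℕ→ℚ n *ℚ ρ^ℤ (suc r) k)) (ℤ.neg-distrib-+ p ℤ.1ℤ) ⟩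
    ρ *ℚ (ℕ→ℚ n *ℚ ρ^ℤ (suc r) (ℤ.- p + ℤ.-1ℤ))   ≡⟨ Q.solve 3 (λ a b c → a Q.:* (b Q.:* c) Q.:= b Q.:* (a Q.:* c)) refl ρ (ℕ→ℚ n) _ ⟩
    ℕ→ℚ n *ℚ (ρ *ℚ ρ^ℤ (suc r) (ℤ.- p + ℤ.-1ℤ))   ≡⟨ cong (ℕ→ℚ n *ℚ_) (ρ*ρ^[k-1]≡ρ^k (ℤ.- p)) ⟩
    ℕ→ℚ n *ℚ ρ^ℤ (suc r) (ℤ.- p)                   ∎
    where open ≡-Reasoning

  module _ {K : Pred} {μ : ℕ} (ρK^μ≡K : ∀ x → K x ⇔ (Σ ℚ λ y → DerivedN μ K y × x ≡ ρ *ℚ y)) where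
    open SelfSimilar K μ ρ ρK^μ≡K

    T-n/ρ^[p+d] : ∀ n p v d → T K v (n /[ suc r ]^ p) → T K (v ℕ.+ d ℕ.* μ) (n /[ suc r ]^ (p + + d))
    T-n/ρ^[p+d] n p v zero T-v =
      subst₂ (λ u k → T K u (n /[ suc r ]^ k)) (sym (ℕ.+-identityʳ v)) (sym (ℤ.+-identityʳ p)) T-v
    T-n/ρ^[p+d] n p v (suc d) T-v = subst₂ (λ u k → T K u (n /[ suc r ]^ k)) levels≡ exponents≡
      (T-scale⇒+μ (v ℕ.+ d ℕ.* μ) (n /[ suc r ]^ (p + + d + ℤ.1ℤ))
        (subst (T K (v ℕ.+ d ℕ.* μ)) (sym (ρ*n/ρ^[p+1]≡n/ρ^p n (p + + d))) (T-n/ρ^[p+d] n p v d T-v)))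
      where
      levels≡ : v ℕ.+ d ℕ.* μ ℕ.+ μ ≡ v ℕ.+ suc d ℕ.* μ
      levels≡ = trans (ℕ.+-assoc v (d ℕ.* μ) μ) (cong (v ℕ.+_) (ℕ.+-comm (d ℕ.* μ) μ))
      exponents≡ : p + + d + ℤ.1ℤ ≡ p + + suc d
      exponents≡ = trans (ℤ.+-assoc p (+ d) ℤ.1ℤ) (cong (λ k → p + k) (ℤ.+-comm (+ d) ℤ.1ℤ))

    pμ-v-constant : ∀ n p v w d → T K v (n /[ suc r ]^ p) → T K w (n /[ suc r ]^ (p + + d)) →
      p * + μ - + v ≡ (p + + d) * + μ - + w
    pμ-v-constant n p v w d T-v T-w = begin
      p * + μ - + v
        ≡⟨ Z.solve 4 (λ p d μ v → p Z.:* μ Z.:- v Z.:= (p Z.:+ d) Z.:* μ Z.:- (v Z.:+ d Z.:* μ)) refl p (+ d) (+ μ) (+ v) ⟩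
      (p + + d) * + μ - (+ v + + d * + μ)
        ≡⟨ cong (λ k → (p + + d) * + μ - (+ v + k)) (ℤ.pos-* d μ) ⟨
      (p + + d) * + μ - (+ v + + (d ℕ.* μ))
        ≡⟨ cong (λ k → (p + + d) * + μ - k) (ℤ.pos-+ v (d ℕ.* μ)) ⟨
      (p + + d) * + μ - + (v ℕ.+ d ℕ.* μ)
        ≡⟨ cong (λ u → (p + + d) * + μ - + u) (T-unique K _ (T-n/ρ^[p+d] n p v d T-v) T-w) ⟩
      (p + + d) * + μ - + w
        ∎
      where open ≡-Reasoning

q≡p+d⊎p≡q+d : ∀ p q → Σ ℕ (λ d → q ≡ p + + d) ⊎ Σ ℕ (λ d → p ≡ q + + d)
q≡p+d⊎p≡q+d p q with q - p in q-p≡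
... | + d      = inj₁ (d , trans (Z.solve 2 (λ p q → q Z.:= p Z.:+ (q Z.:- p)) refl p q) (cong (λ k → p + k) q-p≡))
... | -[1+ d ] = inj₂ (suc d , trans (Z.solve 2 (λ p q → p Z.:= q Z.:+ Z.:- (q Z.:- p)) refl p q) (cong (λ k → q + ℤ.- k) q-p≡))

mainTheorem5 : (ρ μ : ℕ) → 2 ≤ ρ → 1 ≤ μ → (K : Pred) → IsQuasiArithmetic ρ μ K →
    (n : ℕ) (p q : ℤ) (v w : ℕ) →
    T K v (n /[ ρ ]^ p) → T K w (n /[ ρ ]^ q) →
    p * (+ μ) - (+ v) ≡ q * (+ μ) - (+ w)
mainTheorem5 (suc r) μ _ _ K (_ , (_ , _ , _ , ρK^μ≡K) , _) n p q v w T-v T-w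
  with q≡p+d⊎p≡q+d p q
... | inj₁ (d , refl) = pμ-v-constant r ρK^μ≡K n p v w d T-v T-w
... | inj₂ (d , refl) = sym (pμ-v-constant r ρK^μ≡K n q w v d T-w T-v)
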